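{- Let $M$ be a multisymmetric matroid on $\widetilde E=\widetilde E_1\sqcup\cdots\sqcup\widetilde E_n$. If $S\subseteq\widetilde E$ is geometric, then $\mathrm{cl}_M(S)$ is also geometric.
   Context: A matroid on a finite set is given by a rank function that is submodular, monotone, normalized ($\mathrm{rk}(\emptyset)=0$), bounded ($\mathrm{rk}(A)\le|A|$); all matroids are loopless ($\mathrm{rk}(A)>0$ for $A\neq\emptyset$). Flats are subsets maximal among sets of their rank; $\mathrm{cl}_M(S)$ is the smallest flat containing $S$. A multisymmetric matroid is a matroid $M$ on $\widetilde E$ with a partition $\widetilde E=\widetilde E_1\sqcup\cdots\sqcup\widetilde E_n$ such that the action of $\Gamma=\mathfrak S_{\widetilde E_1}\times\cdots\times\mathfrak S_{\widetilde E_n}$ on $\widetilde E$ maps flats to flats. The geometric part of $S\subseteq\widetilde E$ is $S^{\mathrm{geo}}=\bigcap_{\gamma\in\Gamma}\gamma\cdot S$, and $S$ is geometric if $S=S^{\mathrm{geo}}$. -}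

module Defs where

open import Data.Nat using (ℕ; _+_; _≤_; _<_)
open import Data.Fin using (Fin)
open import Data.Fin.Subset using (Subset; _∈_; _⊆_; _∪_; _∩_; ⊥; ∣_∣; Nonempty)
open import Data.Fin.Permutation using (Permutation′; _⟨$⟩ʳ_; _⟨$⟩ˡ_)
open import Data.Vec using (tabulate; lookup)
open import Data.Product using (_×_)
open import Relation.Binary.PropositionalEquality using (_≡_)
open import Function.Bundles using (_⇔_)

record Matroid (m : ℕ) : Set where
  field
    rk          : Subset m → ℕ
    submodular  : ∀ A B → rk (A ∪ B) + rk (A ∩ B) ≤ rk A + rk B
    monotone    : ∀ {A B} → A ⊆ B → rk A ≤ rk B
    normalized  : rk ⊥ ≡ 0
    bounded     : ∀ A → rk A ≤ ∣ A ∣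
    loopless    : ∀ A → Nonempty A → 0 < rk A

open Matroid public

IsFlat : ∀ {m} → Matroid m → Subset m → Set
IsFlat M F = ∀ G → F ⊆ G → rk M G ≡ rk M F → G ≡ F

IsClosure : ∀ {m} → Matroid m → Subset m → Subset m → Set
IsClosure M S C =
  IsFlat M C × S ⊆ C × (∀ F → IsFlat M F → S ⊆ F → C ⊆ F)

-- Action of a permutation on subsets: γ · S = { γ x | x ∈ S }.
_·_ : ∀ {m} → Permutation′ m → Subset m → Subset m
γ · S = tabulate (λ y → lookup S (γ ⟨$⟩ˡ y))

-- The partition Ẽ = Ẽ₁ ⊔ ... ⊔ Ẽₙ is given by a block map part : Fin m → Fin n.
-- γ ∈ Γ = 𝔖_{Ẽ₁} × ... × 𝔖_{Ẽₙ}  iff  γ preserves every block.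
InΓ : ∀ {m n} → (Fin m → Fin n) → Permutation′ m → Set
InΓ part γ = ∀ x → part (γ ⟨$⟩ʳ x) ≡ part x

IsMultisymmetric : ∀ {m n} → Matroid m → (Fin m → Fin n) → Set
IsMultisymmetric M part =
  ∀ γ → InΓ part γ → ∀ F → IsFlat M F → IsFlat M (γ · F)

_∈geo_ : ∀ {m n} {part : Fin m → Fin n} → Fin m → Subset m → Set
_∈geo_ {part = part} x S = ∀ γ → InΓ part γ → x ∈ γ · S

IsGeometric : ∀ {m n} → (Fin m → Fin n) → Subset m → Set
IsGeometric part S = ∀ x → (x ∈ S) ⇔ (_∈geo_ {part = part} x S)

{-# OPTIONS --safe #-}
module Submission where

open import Defs
open import Data.Nat using (ℕ)
open import Data.Fin using (Fin)
open import Data.Fin.Subset using (Subset; _∈_; _⊆_)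
open import Data.Fin.Permutation using (Permutation′; _⟨$⟩ˡ_; id)
open import Data.Vec.Properties using ([]=⇒lookup; lookup⇒[]=; lookup∘tabulate)
open import Data.Product using (_,_)
open import Relation.Binary.PropositionalEquality using (refl; trans; sym)
open import Function.Bundles using (_⇔_; mk⇔; Equivalence)

-- Γ fixes a geometric S setwise, and a Γ-translate of the flat cl(S) is again
-- a flat containing S, hence contains cl(S).  So every γ ∈ Γ maps cl(S) onto
-- a superset of itself, which is exactly what makes cl(S) geometric.

module _ {m : ℕ} (γ : Permutation′ m) where

  ∈·⇒ : ∀ {S : Subset m} {x} → x ∈ γ · S → (γ ⟨$⟩ˡ x) ∈ S
  ∈·⇒ {S} {x} x∈γS =
    lookup⇒[]= _ S (trans (sym (lookup∘tabulate _ x)) ([]=⇒lookup x∈γS))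

  ∈·⇐ : ∀ {S : Subset m} {x} → (γ ⟨$⟩ˡ x) ∈ S → x ∈ γ · S
  ∈·⇐ {S} {x} γ⁻¹x∈S =
    lookup⇒[]= x (γ · S) (trans (lookup∘tabulate _ x) ([]=⇒lookup γ⁻¹x∈S))

  ·-mono-⊆ : ∀ {S T : Subset m} → S ⊆ T → γ · S ⊆ γ · T
  ·-mono-⊆ S⊆T x∈γS = ∈·⇐ (S⊆T (∈·⇒ x∈γS))

module _ {m n : ℕ} {part : Fin m → Fin n} where

  ∈geo⇒∈ : ∀ {S : Subset m} {x} → _∈geo_ {part = part} x S → x ∈ S
  ∈geo⇒∈ x∈geoS = ∈·⇒ id (x∈geoS id (λ _ → refl))

  geometric⇒⊆translate : ∀ {S : Subset m} → IsGeometric part S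
    → ∀ γ → InΓ part γ → S ⊆ γ · S
  geometric⇒⊆translate geoS γ γ∈Γ {x} x∈S = Equivalence.to (geoS x) x∈S γ γ∈Γ

  ⊆translates⇒geometric : ∀ {S : Subset m} → (∀ γ → InΓ part γ → S ⊆ γ · S)
    → IsGeometric part S
  ⊆translates⇒geometric S⊆γS x = mk⇔ (λ x∈S γ γ∈Γ → S⊆γS γ γ∈Γ x∈S) ∈geo⇒∈

  closure-⊆translate : ∀ (M : Matroid m) → IsMultisymmetric M part
    → ∀ {S C : Subset m} → IsClosure M S C
    → ∀ γ → InΓ part γ → S ⊆ γ · S → C ⊆ γ · C
  closure-⊆translate M ms {C = C} (flatC , S⊆C , minimalC) γ γ∈Γ S⊆γS =
    minimalC (γ · C) (ms γ γ∈Γ _ flatC) (λ x∈S → ·-mono-⊆ γ S⊆C (S⊆γS x∈S))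

lemma2p5 : ∀ {m n : ℕ} (M : Matroid m) (part : Fin m → Fin n)
    → IsMultisymmetric M part
    → ∀ (S C : Subset m) → IsGeometric part S → IsClosure M S C
    → IsGeometric part C
lemma2p5 M part ms S C geoS clC =
  ⊆translates⇒geometric λ γ γ∈Γ →
    closure-⊆translate M ms clC γ γ∈Γ (geometric⇒⊆translate geoS γ γ∈Γ)
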